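{- Every element of a tame tree set $\tau$ lies in some splitting star of $\tau$.
   Context: A separation system is a poset with an order-reversing involution $^*$; write $\overleftarrow s=\vec s^{\,*}$ and $s=\{\vec s,\overleftarrow s\}$. $\vec s$ is trivial if $\vec s\le\vec r,\overleftarrow r$ for some $r\ne s$. A tree set is a separation system whose separations are pairwise nested (have comparable orientations) and which has no trivial element. It is tame if it contains no chain of order type $\omega+1$. An orientation $O$ contains exactly one of $\vec s,\overleftarrow s$ for each $s$; it is consistent if $\vec r,\vec s\in O$, $\overleftarrow s\le\vec r$ imply $r=s$; it is splitting if it is consistent and every element of $O$ lies below some maximal element of $O$. A splitting star of $\tau$ is the set of maximal elements of a splitting orientation of $\tau$. -}

module Defs where

open import Data.Nat using (ℕ; suc)
open import Data.Product using (Σ; ∃; _×_; _,_)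
open import Data.Sum using (_⊎_)
open import Relation.Nullary using (¬_)
open import Relation.Binary.PropositionalEquality using (_≡_; _≢_)
open import Relation.Binary.Structures using (IsPartialOrder)

record SeparationSystem : Set₁ where
  field
    Carrier      : Set
    _≤_          : Carrier → Carrier → Set
    isPartialOrder : IsPartialOrder _≡_ _≤_
    _*           : Carrier → Carrier
    involutive   : ∀ x → (x *) * ≡ x
    order-reversing : ∀ {x y} → x ≤ y → (y *) ≤ (x *)

  infix 4 _≤_ _<_
  infix 10 _*

  _<_ : Carrier → Carrier → Set
  x < y = x ≤ y × x ≢ y

  SameSep : Carrier → Carrier → Set
  SameSep x y = x ≡ y ⊎ x ≡ y *

  Trivial : Carrier → Set
  Trivial x = ∃ λ y → ¬ SameSep y x × x ≤ y × x ≤ y *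

  Nested : Carrier → Carrier → Set
  Nested x y = (x ≤ y ⊎ y ≤ x) ⊎ (x ≤ y * ⊎ y * ≤ x)
             ⊎ (x * ≤ y ⊎ y ≤ x *) ⊎ (x * ≤ y * ⊎ y * ≤ x *)

  IsTreeSet : Set
  IsTreeSet = (∀ x y → Nested x y) × (∀ x → ¬ Trivial x)

  -- tame: no chain of order type ω+1, i.e. no strictly increasing
  -- sequence c₀ < c₁ < … together with an element above all of them
  IsTame : Set
  IsTame = ¬ (Σ (ℕ → Carrier) λ c →
                 (∀ n → c n < c (suc n)) × (∃ λ top → ∀ n → c n < top))

  -- orientation (as a subset O of the carrier): O contains exactly one
  -- element of the set {x, x*} for every x
  IsOrientation : (Carrier → Set) → Set
  IsOrientation O = ∀ x → (O x ⊎ O (x *)) × (O x → O (x *) → x ≡ x *)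

  IsConsistent : (Carrier → Set) → Set
  IsConsistent O = ∀ r s → O r → O s → s * ≤ r → SameSep r s

  IsMaximalIn : (Carrier → Set) → Carrier → Set
  IsMaximalIn O m = O m × (∀ y → O y → m ≤ y → y ≡ m)

  IsSplitting : (Carrier → Set) → Set
  IsSplitting O = IsOrientation O × IsConsistent O
                × (∀ x → O x → ∃ λ m → IsMaximalIn O m × x ≤ m)

  -- x lies in some splitting star (the set of maximal elements of a
  -- splitting orientation)
  InSomeSplittingStar : Carrier → Set₁
  InSomeSplittingStar x = Σ (Carrier → Set) λ O → IsSplitting O × IsMaximalIn O x

module Submission where

-- The orientation is the one pointing towards x:
--   O = {x} ∪ {y : y is not an orientation of x, and y ≤ x or y ≤ x*}.
-- Nestedness puts, for every y not an orientation of x, one of y and y*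
-- below x or x*; absence of trivial separations prevents both from being
-- below.  Hence O is an orientation, it is consistent, and x is maximal
-- in O.  Elements of O below x are below the maximal element x.  For an
-- element y ≤ x* of O, every element of O above y is strictly below x*;
-- a general fact about tame separation systems (proved using excluded
-- middle) then gives a maximal element of O above y.

open import Defs
open import Level using (0ℓ)
open import Axiom.ExcludedMiddle using (ExcludedMiddle)
open import Data.Nat using (ℕ; zero; suc)
open import Data.Product using (Σ; ∃; _×_; _,_; proj₁; proj₂)
open import Data.Sum using (_⊎_; inj₁; inj₂)
open import Data.Empty using (⊥; ⊥-elim)
open import Relation.Nullary using (¬_; yes; no)
open import Relation.Binary.PropositionalEquality
  using (_≡_; refl; sym; trans; subst; subst₂; cong)
open import Relation.Binary.Structures using (IsPartialOrder)

module SeparationFacts (τ : SeparationSystem) where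
  open SeparationSystem τ
  open IsPartialOrder isPartialOrder public
    using (antisym) renaming (refl to ≤-refl; trans to ≤-trans)

  ≤*⇒≤* : ∀ {a b} → a ≤ b * → b ≤ a *
  ≤*⇒≤* {a} {b} p = subst (_≤ a *) (involutive b) (order-reversing p)

  *≤⇒*≤ : ∀ {a b} → a * ≤ b → b * ≤ a
  *≤⇒*≤ {a} {b} p = subst (b * ≤_) (involutive a) (order-reversing p)

  *≤*⇒≥ : ∀ {a b} → a * ≤ b * → b ≤ a
  *≤*⇒≥ {a} {b} p = subst₂ _≤_ (involutive b) (involutive a) (order-reversing p)

  SameSep-sym : ∀ {a b} → SameSep a b → SameSep b a
  SameSep-sym (inj₁ e) = inj₁ (sym e)
  SameSep-sym {a} {b} (inj₂ e) = inj₂ (sym (trans (cong _* e) (involutive b)))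

  SameSep-*ʳ : ∀ {a b} → SameSep a (b *) → SameSep a b
  SameSep-*ʳ (inj₁ e) = inj₂ e
  SameSep-*ʳ {b = b} (inj₂ e) = inj₁ (trans e (involutive b))

  SameSep-*ˡ : ∀ {a b} → SameSep (a *) b → SameSep a b
  SameSep-*ˡ s = SameSep-sym (SameSep-*ʳ (SameSep-sym s))

  Below : Carrier → Carrier → Set
  Below y x = y ≤ x ⊎ y ≤ x *

  Below-≤ : ∀ {s r a} → s ≤ r → Below r a → Below s a
  Below-≤ h (inj₁ p) = inj₁ (≤-trans h p)
  Below-≤ h (inj₂ p) = inj₂ (≤-trans h p)

module TameFacts (em : ExcludedMiddle 0ℓ) (τ : SeparationSystem)
                 (tame : SeparationSystem.IsTame τ) where
  open SeparationSystem τ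
  open SeparationFacts τ

  non-maximal⇒larger : ∀ (P : Carrier → Set) z → P z → ¬ IsMaximalIn P z →
                       ∃ λ w → P w × z < w
  non-maximal⇒larger P z pz ¬maximal with em {∃ λ w → P w × z < w}
  ... | yes larger = larger
  ... | no ¬larger = ⊥-elim (¬maximal (pz , maximal))
    where
    maximal : ∀ w → P w → z ≤ w → w ≡ z
    maximal w pw zw with em {w ≡ z}
    ... | yes e = e
    ... | no w≢z = ⊥-elim (¬larger (w , pw , zw , λ e → w≢z (sym e)))

  -- If the elements of P above y ∈ P are all strictly below one common
  -- bound, then y lies below a maximal element of P: otherwise repeatedly
  -- passing to a larger element yields an ω-chain with an upper bound.
  maximal-above : ∀ (P : Carrier → Set) y top → P y →
                  (∀ z → P z → y ≤ z → z < top) →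
                  ∃ λ m → IsMaximalIn P m × y ≤ m
  maximal-above P y top py bounded with em {∃ λ m → IsMaximalIn P m × y ≤ m}
  ... | yes found = found
  ... | no ¬found = ⊥-elim (tame (chain , increasing , top , below-top))
    where
    Above : Set
    Above = Σ Carrier λ z → P z × y ≤ z

    step : (a : Above) → Σ Above λ b → proj₁ a < proj₁ b
    step (z , pz , yz) with non-maximal⇒larger P z pz (λ mz → ¬found (z , mz , yz))
    ... | w , pw , z<w = (w , pw , ≤-trans yz (proj₁ z<w)) , z<w

    walk : ℕ → Above
    walk zero = y , py , ≤-refl
    walk (suc k) = proj₁ (step (walk k))

    chain : ℕ → Carrier
    chain k = proj₁ (walk k)

    increasing : ∀ k → chain k < chain (suc k)
    increasing k = proj₂ (step (walk k))

    below-top : ∀ k → chain k < top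
    below-top k = bounded (chain k) (proj₁ (proj₂ (walk k))) (proj₂ (proj₂ (walk k)))

module TreeSetFacts (τ : SeparationSystem) (tree : SeparationSystem.IsTreeSet τ) where
  open SeparationSystem τ
  open SeparationFacts τ

  nested : ∀ x y → Nested x y
  nested = proj₁ tree

  nontrivial : ∀ x → ¬ Trivial x
  nontrivial = proj₂ tree

  some-side-below : ∀ x y → Below y x ⊎ Below (y *) x
  some-side-below x y with nested x y
  ... | inj₁ (inj₁ p)               = inj₂ (inj₂ (order-reversing p))
  ... | inj₁ (inj₂ p)               = inj₁ (inj₁ p)
  ... | inj₂ (inj₁ (inj₁ p))        = inj₁ (inj₂ (≤*⇒≤* p))
  ... | inj₂ (inj₁ (inj₂ p))        = inj₂ (inj₁ p)
  ... | inj₂ (inj₂ (inj₁ (inj₁ p))) = inj₂ (inj₁ (*≤⇒*≤ p))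
  ... | inj₂ (inj₂ (inj₁ (inj₂ p))) = inj₁ (inj₂ p)
  ... | inj₂ (inj₂ (inj₂ (inj₁ p))) = inj₁ (inj₁ (*≤*⇒≥ p))
  ... | inj₂ (inj₂ (inj₂ (inj₂ p))) = inj₂ (inj₂ p)

  -- If both orientations of s lie below a, then a* is trivial.
  both-orientations-below : ∀ {s a} → ¬ SameSep s a → s ≤ a → s * ≤ a → ⊥
  both-orientations-below {s} {a} n p q =
    nontrivial (a *) (s , (λ e → n (SameSep-*ʳ e)) , *≤⇒*≤ q , order-reversing p)

  one-side-below : ∀ {y x} → ¬ SameSep y x → Below y x → Below (y *) x → ⊥
  one-side-below n (inj₁ p) (inj₁ q) = both-orientations-below n p q
  one-side-below n (inj₂ p) (inj₂ q) = both-orientations-below (λ e → n (SameSep-*ʳ e)) p q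
  one-side-below n (inj₁ p) (inj₂ q) = n (inj₁ (antisym p (*≤*⇒≥ q)))
  one-side-below n (inj₂ p) (inj₁ q) = n (inj₂ (antisym p (*≤⇒*≤ q)))

module TowardsX (em : ExcludedMiddle 0ℓ) (τ : SeparationSystem)
                (tree : SeparationSystem.IsTreeSet τ) (tame : SeparationSystem.IsTame τ)
                (x : SeparationSystem.Carrier τ) where
  open SeparationSystem τ
  open SeparationFacts τ
  open TameFacts em τ tame
  open TreeSetFacts τ tree

  O : Carrier → Set
  O y = y ≡ x ⊎ (¬ SameSep y x × Below y x)

  -- Decide whether y is an orientation of x; otherwise nestedness picks
  -- the side of y below x, and non-triviality makes that side unique.
  O-orientation : IsOrientation O
  O-orientation y = some-side , one-side
    where
    some-side : O y ⊎ O (y *)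
    some-side with em {SameSep y x}
    ... | yes (inj₁ e) = inj₁ (inj₁ e)
    ... | yes (inj₂ e) = inj₂ (inj₁ (trans (cong _* e) (involutive x)))
    ... | no n with some-side-below x y
    ...   | inj₁ b = inj₁ (inj₂ (n , b))
    ...   | inj₂ b = inj₂ (inj₂ ((λ e → n (SameSep-*ˡ e)) , b))

    one-side : O y → O (y *) → y ≡ y *
    one-side (inj₁ e) (inj₁ e′) = trans e (sym e′)
    one-side (inj₁ e) (inj₂ (n , _)) = ⊥-elim (n (inj₂ (cong _* e)))
    one-side (inj₂ (n , _)) (inj₁ e′) =
      ⊥-elim (n (inj₂ (trans (sym (involutive y)) (cong _* e′))))
    one-side (inj₂ (n , b)) (inj₂ (_ , b*)) = ⊥-elim (one-side-below n b b*)

  -- Each case puts s* below x, contradicting that s ∈ O.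
  O-consistent : IsConsistent O
  O-consistent r s (inj₁ e) (inj₁ e′) h = inj₁ (trans e (sym e′))
  O-consistent r s (inj₁ e) (inj₂ (n , b)) h =
    ⊥-elim (one-side-below n b (inj₁ (subst (s * ≤_) e h)))
  O-consistent r s (inj₂ (n , b)) (inj₁ e′) h =
    ⊥-elim (one-side-below n b (inj₁ (*≤⇒*≤ (subst (λ t → t * ≤ r) e′ h))))
  O-consistent r s (inj₂ (n , b)) (inj₂ (m , c)) h =
    ⊥-elim (one-side-below m c (Below-≤ h b))

  -- An element w ≤ x* of O above x would make x trivial.
  x-maximal : IsMaximalIn O x
  x-maximal = inj₁ refl , maximal
    where
    maximal : ∀ w → O w → x ≤ w → w ≡ x
    maximal w (inj₁ e) _ = e
    maximal w (inj₂ (_ , inj₁ p)) h = antisym p h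
    maximal w (inj₂ (n , inj₂ p)) h = ⊥-elim (nontrivial x (w , n , h , ≤*⇒≤* p))

  -- Elements of O above some y ≤ x* (y not an orientation of x) stay
  -- strictly below x*, since y ≤ x as well would make y trivial.
  bounded-by-x* : ∀ {y} → ¬ SameSep y x → y ≤ x * → ∀ z → O z → y ≤ z → z < x *
  bounded-by-x* {y} n p z (inj₁ e) yz =
    ⊥-elim (nontrivial y (x , (λ e′ → n (SameSep-sym e′)) , subst (y ≤_) e yz , p))
  bounded-by-x* {y} n p z (inj₂ (_ , inj₁ q)) yz =
    ⊥-elim (nontrivial y (x , (λ e′ → n (SameSep-sym e′)) , ≤-trans yz q , p))
  bounded-by-x* n p z (inj₂ (m , inj₂ q)) yz = q , λ e → m (inj₂ e)

  below-maximal : ∀ z → O z → ∃ λ m → IsMaximalIn O m × z ≤ m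
  below-maximal z (inj₁ e) = x , x-maximal , subst (_≤ x) (sym e) ≤-refl
  below-maximal z (inj₂ (_ , inj₁ p)) = x , x-maximal , p
  below-maximal z (inj₂ (n , inj₂ p)) =
    maximal-above O z (x *) (inj₂ (n , inj₂ p)) (bounded-by-x* n p)

lemma2p4 : ExcludedMiddle 0ℓ → (τ : SeparationSystem) →
    SeparationSystem.IsTreeSet τ → SeparationSystem.IsTame τ →
    ∀ x → SeparationSystem.InSomeSplittingStar τ x
lemma2p4 em τ tree tame x = O , (O-orientation , O-consistent , below-maximal) , x-maximal
  where open TowardsX em τ tree tame x
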